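{- Let $Y_n = \frac{1}{2\sqrt{3}}\left((2+\sqrt{3})^n - (2-\sqrt{3})^n\right)$ for integers $n \ge 0$. Then for every $n\ge 0$, \[ Y_n \;=\; \sum_{\substack{k \geq 1\\ k \text{ odd}}} (-1)^{(k-1)/2} \binom{2n}{n+k} \left(\frac{k}{12}\right) \;=\; \sum_{j \geq 0} (-1)^j\left(\binom{2n}{n+6j+1} - \binom{2n}{n+6j+5}\right). \]
   Context: Binomial coefficients $\binom{m}{i}$ are taken to be $0$ for $i<0$ and for $i>m$. The Kronecker symbol $\left(\frac{k}{12}\right)$ equals $1$ for $k\equiv 1,7 \pmod{12}$, equals $-1$ for $k \equiv 5,11 \pmod{12}$, and equals $0$ otherwise (in particular it vanishes for even $k$). -}

module Defs where

open import Data.Nat using (ℕ; zero; suc)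
import Data.Nat as ℕ
open import Data.Nat.Combinatorics using (_C_)
open import Data.Integer using (ℤ; +_; -_; _+_; _-_; _*_; 0ℤ; 1ℤ)

-- The ring ℤ[√3]: an element  a + b√3  is represented by ⟨ a , b ⟩.
record ℤ√3 : Set where
  constructor ⟨_,_⟩
  field
    re : ℤ
    im : ℤ
open ℤ√3 public

infixl 6 _⊕_ _⊖_
infixl 7 _⊗_

_⊕_ : ℤ√3 → ℤ√3 → ℤ√3
⟨ a , b ⟩ ⊕ ⟨ c , d ⟩ = ⟨ a + c , b + d ⟩

_⊖_ : ℤ√3 → ℤ√3 → ℤ√3
⟨ a , b ⟩ ⊖ ⟨ c , d ⟩ = ⟨ a - c , b - d ⟩

-- (a + b√3)(c + d√3) = (ac + 3bd) + (ad + bc)√3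
_⊗_ : ℤ√3 → ℤ√3 → ℤ√3
⟨ a , b ⟩ ⊗ ⟨ c , d ⟩ = ⟨ a * c + + 3 * (b * d) , a * d + b * c ⟩

one√ : ℤ√3
one√ = ⟨ 1ℤ , 0ℤ ⟩

ι : ℤ → ℤ√3
ι z = ⟨ z , 0ℤ ⟩

_^√_ : ℤ√3 → ℕ → ℤ√3
x ^√ zero  = one√
x ^√ suc n = x ⊗ (x ^√ n)

α β twoSqrt3 : ℤ√3
α = ⟨ + 2 , 1ℤ ⟩
β = ⟨ + 2 , - 1ℤ ⟩
twoSqrt3 = ⟨ 0ℤ , + 2 ⟩

-- "Y_n = ((2+√3)^n - (2-√3)^n) / (2√3) equals y", i.e.
-- (2+√3)^n - (2-√3)^n = 2√3 · y  in ℤ[√3] (2√3 is a non-zero-divisor).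
IsY : ℕ → ℤ → Set
IsY n y = (α ^√ n) ⊖ (β ^√ n) ≡ twoSqrt3 ⊗ ι y
  where open import Relation.Binary.PropositionalEquality using (_≡_)

Σ< : ℕ → (ℕ → ℤ) → ℤ
Σ< zero    f = 0ℤ
Σ< (suc N) f = Σ< N f + f N

sgn : ℕ → ℤ
sgn zero    = 1ℤ
sgn (suc m) = - sgn m

-- binomial coefficient as an integer (zero when i > m)
binom : ℕ → ℕ → ℤ
binom m i = + (m C i)

kron12 : ℕ → ℤ
kron12 k with k ℕ.% 12
... | 1  = 1ℤ
... | 7  = 1ℤ
... | 5  = - 1ℤ
... | 11 = - 1ℤ
... | _  = 0ℤ

-- Σ_{k ≥ 1, k odd} (-1)^{(k-1)/2} C(2n, n+k) (k/12), writing k = 2m+1.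
-- Terms with k > n vanish, so summing m = 0..n covers all nonzero terms.
S₁ : ℕ → ℤ
S₁ n = Σ< (suc n) λ m →
  sgn m * binom (2 ℕ.* n) (n ℕ.+ (2 ℕ.* m ℕ.+ 1)) * kron12 (2 ℕ.* m ℕ.+ 1)

-- Σ_{j ≥ 0} (-1)^j (C(2n, n+6j+1) - C(2n, n+6j+5)); terms with j > n vanish.
S₂ : ℕ → ℤ
S₂ n = Σ< (suc n) λ j →
  sgn j * (binom (2 ℕ.* n) (n ℕ.+ 6 ℕ.* j ℕ.+ 1) - binom (2 ℕ.* n) (n ℕ.+ 6 ℕ.* j ℕ.+ 5))

-- Let χ be the even character mod 12 (χ k = 1 for k ≡ ±1, −1 for k ≡ ±5). Both sums
-- regroup to Σ_{k ≥ 1} χ k · C(2n, n + k), which is half of the symmetric sum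
-- T n = Σ_{|k| ≤ n} χ k · C(2n, n + k). Passing from 2n to 2n + 2 in the binomial
-- multiplies by x⁻¹ + 2 + x, i.e. applies the smoothing S f k = f (k − 1) + 2 f k + f (k + 1)
-- to χ. A direct check on the twelve residues gives S² χ + χ = 4 S χ, so T satisfies
-- T (n + 2) + T n = 4 T (n + 1) with T 0 = 0 and T 1 = 2. This is the recurrence of
-- 2 Y n, as 2 ± √3 are the roots of t² − 4t + 1.
module Submission where

open import Defs
open import Data.Nat as ℕ using (ℕ; zero; suc; _≤_; _<_; s≤s)
import Data.Nat.Properties as ℕₚ
import Data.Nat.Tactic.RingSolver as ℕ-Solver
open import Data.Nat.Combinatorics using (_C_; nCk+nC[k+1]≡[n+1]C[k+1]; k>n⇒nCk≡0; nCk≡nC[n∸k])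
open import Data.Integer using (ℤ; +_; -_; _+_; _-_; _*_; 0ℤ; 1ℤ)
import Data.Integer.Properties as ℤₚ
open import Data.Integer.Tactic.RingSolver using (solve-∀)
open import Data.Product using (_×_; _,_)
open import Relation.Binary.PropositionalEquality
open ≡-Reasoning

Σ<-cong : ∀ N {f g : ℕ → ℤ} → (∀ i → f i ≡ g i) → Σ< N f ≡ Σ< N g
Σ<-cong zero    f≗g = refl
Σ<-cong (suc N) f≗g = cong₂ _+_ (Σ<-cong N f≗g) (f≗g N)

Σ<-cong-< : ∀ N {f g : ℕ → ℤ} → (∀ i → i < N → f i ≡ g i) → Σ< N f ≡ Σ< N g
Σ<-cong-< zero    f≗g = refl
Σ<-cong-< (suc N) f≗g =
  cong₂ _+_ (Σ<-cong-< N λ i i<N → f≗g i (ℕₚ.m<n⇒m<1+n i<N)) (f≗g N ℕₚ.≤-refl)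

Σ<-zero : ∀ N → Σ< N (λ _ → 0ℤ) ≡ 0ℤ
Σ<-zero zero    = refl
Σ<-zero (suc N) = cong (_+ 0ℤ) (Σ<-zero N)

Σ<-distrib-+ : ∀ N (f g : ℕ → ℤ) → Σ< N (λ i → f i + g i) ≡ Σ< N f + Σ< N g
Σ<-distrib-+ zero    f g = refl
Σ<-distrib-+ (suc N) f g = begin
  Σ< N (λ i → f i + g i) + (f N + g N) ≡⟨ cong (_+ (f N + g N)) (Σ<-distrib-+ N f g) ⟩
  Σ< N f + Σ< N g + (f N + g N)        ≡⟨ interchange (Σ< N f) (Σ< N g) (f N) (g N) ⟩
  Σ< N f + f N + (Σ< N g + g N)        ∎
  where
  interchange : ∀ a b c d → a + b + (c + d) ≡ a + c + (b + d)
  interchange = solve-∀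

Σ<-*ˡ : ∀ N a (f : ℕ → ℤ) → Σ< N (λ i → a * f i) ≡ a * Σ< N f
Σ<-*ˡ zero    a f = sym (ℤₚ.*-zeroʳ a)
Σ<-*ˡ (suc N) a f = begin
  Σ< N (λ i → a * f i) + a * f N ≡⟨ cong (_+ a * f N) (Σ<-*ˡ N a f) ⟩
  a * Σ< N f + a * f N           ≡⟨ sym (ℤₚ.*-distribˡ-+ a (Σ< N f) (f N)) ⟩
  a * (Σ< N f + f N)             ∎

Σ<-head : ∀ N f → Σ< (suc N) f ≡ f 0 + Σ< N (λ i → f (suc i))
Σ<-head zero    f = ℤₚ.+-comm 0ℤ (f 0)
Σ<-head (suc N) f = begin
  Σ< (suc N) f + f (suc N)                 ≡⟨ cong (_+ f (suc N)) (Σ<-head N f) ⟩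
  f 0 + Σ< N (λ i → f (suc i)) + f (suc N) ≡⟨ ℤₚ.+-assoc (f 0) _ _ ⟩
  f 0 + Σ< (suc N) (λ i → f (suc i))       ∎

Σ<-split : ∀ a b f → Σ< (a ℕ.+ b) f ≡ Σ< a f + Σ< b (λ i → f (a ℕ.+ i))
Σ<-split a zero    f rewrite ℕₚ.+-identityʳ a = sym (ℤₚ.+-identityʳ _)
Σ<-split a (suc b) f rewrite ℕₚ.+-suc a b = begin
  Σ< (a ℕ.+ b) f + f (a ℕ.+ b)                    ≡⟨ cong (_+ f (a ℕ.+ b)) (Σ<-split a b f) ⟩
  Σ< a f + Σ< b (λ i → f (a ℕ.+ i)) + f (a ℕ.+ b) ≡⟨ ℤₚ.+-assoc (Σ< a f) _ _ ⟩
  Σ< a f + Σ< (suc b) (λ i → f (a ℕ.+ i))         ∎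

Σ<-reverse : ∀ N f → Σ< N f ≡ Σ< N (λ i → f (N ℕ.∸ suc i))
Σ<-reverse zero    f = refl
Σ<-reverse (suc N) f = begin
  Σ< N f + f N                         ≡⟨ cong (_+ f N) (Σ<-reverse N f) ⟩
  Σ< N (λ i → f (N ℕ.∸ suc i)) + f N   ≡⟨ ℤₚ.+-comm _ (f N) ⟩
  f N + Σ< N (λ i → f (N ℕ.∸ suc i))   ≡⟨ sym (Σ<-head N (λ i → f (suc N ℕ.∸ suc i))) ⟩
  Σ< (suc N) (λ i → f (suc N ℕ.∸ suc i)) ∎

Σ<-truncate : ∀ {n} M f → n ≤ M → (∀ r → n ≤ r → f r ≡ 0ℤ) → Σ< M f ≡ Σ< n f
Σ<-truncate {n} M f n≤M tail≡0 = begin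
  Σ< M f                                       ≡⟨ cong (λ K → Σ< K f) (sym (ℕₚ.m+[n∸m]≡n n≤M)) ⟩
  Σ< (n ℕ.+ (M ℕ.∸ n)) f                       ≡⟨ Σ<-split n (M ℕ.∸ n) f ⟩
  Σ< n f + Σ< (M ℕ.∸ n) (λ i → f (n ℕ.+ i))   ≡⟨ cong (λ t → Σ< n f + t) tail ⟩
  Σ< n f + 0ℤ                                  ≡⟨ ℤₚ.+-identityʳ _ ⟩
  Σ< n f                                       ∎
  where
  tail : Σ< (M ℕ.∸ n) (λ i → f (n ℕ.+ i)) ≡ 0ℤ
  tail = trans (Σ<-cong (M ℕ.∸ n) λ i → tail≡0 (n ℕ.+ i) (ℕₚ.m≤m+n n i)) (Σ<-zero (M ℕ.∸ n))

Σ<-blocks : ∀ N b f → Σ< (N ℕ.* b) f ≡ Σ< N (λ j → Σ< b (λ k → f (j ℕ.* b ℕ.+ k)))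
Σ<-blocks zero    b f = refl
Σ<-blocks (suc N) b f = begin
  Σ< (b ℕ.+ N ℕ.* b) f
    ≡⟨ Σ<-split b (N ℕ.* b) f ⟩
  Σ< b f + Σ< (N ℕ.* b) (λ i → f (b ℕ.+ i))
    ≡⟨ cong (λ t → Σ< b f + t) (Σ<-blocks N b (λ i → f (b ℕ.+ i))) ⟩
  Σ< b f + Σ< N (λ j → Σ< b (λ k → f (b ℕ.+ (j ℕ.* b ℕ.+ k))))
    ≡⟨ cong (λ t → Σ< b f + t) (Σ<-cong N λ j → Σ<-cong b λ k → cong f (sym (ℕₚ.+-assoc b (j ℕ.* b) k))) ⟩
  Σ< b f + Σ< N (λ j → Σ< b (λ k → f (suc j ℕ.* b ℕ.+ k)))
    ≡⟨ sym (Σ<-head N (λ j → Σ< b (λ k → f (j ℕ.* b ℕ.+ k)))) ⟩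
  Σ< (suc N) (λ j → Σ< b (λ k → f (j ℕ.* b ℕ.+ k))) ∎

binomialSum : ℕ → (ℕ → ℤ) → ℤ
binomialSum m g = Σ< (suc m) (λ i → g i * binom m i)

binomialSum-cong : ∀ m {g h : ℕ → ℤ} → (∀ i → g i ≡ h i) → binomialSum m g ≡ binomialSum m h
binomialSum-cong m g≗h = Σ<-cong (suc m) λ i → cong (_* binom m i) (g≗h i)

binomialSum-+ : ∀ m g h → binomialSum m (λ i → g i + h i) ≡ binomialSum m g + binomialSum m h
binomialSum-+ m g h = trans (Σ<-cong (suc m) λ i → ℤₚ.*-distribʳ-+ (binom m i) (g i) (h i))
                            (Σ<-distrib-+ (suc m) _ _)

binomialSum-*ˡ : ∀ m a g → binomialSum m (λ i → a * g i) ≡ a * binomialSum m g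
binomialSum-*ˡ m a g = trans (Σ<-cong (suc m) λ i → ℤₚ.*-assoc a (g i) (binom m i))
                             (Σ<-*ˡ (suc m) a _)

binomialSum-suc : ∀ m g → binomialSum (suc m) g ≡ binomialSum m g + binomialSum m (λ i → g (suc i))
binomialSum-suc m g = begin
  binomialSum (suc m) g
    ≡⟨ Σ<-head (suc m) _ ⟩
  g 0 * 1ℤ + Σ< (suc m) (λ i → g (suc i) * binom (suc m) (suc i))
    ≡⟨ cong (λ t → g 0 * 1ℤ + t) (Σ<-cong (suc m) pascal) ⟩
  g 0 * 1ℤ + Σ< (suc m) (λ i → shifted i + g (suc i) * binom m i)
    ≡⟨ cong (λ t → g 0 * 1ℤ + t) (Σ<-distrib-+ (suc m) shifted _) ⟩
  g 0 * 1ℤ + (Σ< m shifted + g (suc m) * binom m (suc m) + binomialSum m (λ i → g (suc i)))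
    ≡⟨ cong (λ c → g 0 * 1ℤ + (Σ< m shifted + g (suc m) * c + binomialSum m (λ i → g (suc i)))) binom-top ⟩
  g 0 * 1ℤ + (Σ< m shifted + g (suc m) * 0ℤ + binomialSum m (λ i → g (suc i)))
    ≡⟨ drop-zero (g 0 * 1ℤ) (Σ< m shifted) (g (suc m)) _ ⟩
  g 0 * 1ℤ + Σ< m shifted + binomialSum m (λ i → g (suc i))
    ≡⟨ cong (_+ binomialSum m (λ i → g (suc i))) (sym (Σ<-head m _)) ⟩
  binomialSum m g + binomialSum m (λ i → g (suc i)) ∎
  where
  shifted : ℕ → ℤ
  shifted i = g (suc i) * binom m (suc i)
  pascal : ∀ i → g (suc i) * binom (suc m) (suc i) ≡ shifted i + g (suc i) * binom m i
  pascal i = begin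
    g (suc i) * binom (suc m) (suc i)
      ≡⟨ cong (λ c → g (suc i) * + c) (sym (nCk+nC[k+1]≡[n+1]C[k+1] m i)) ⟩
    g (suc i) * (binom m i + binom m (suc i))
      ≡⟨ ℤₚ.*-distribˡ-+ (g (suc i)) (binom m i) (binom m (suc i)) ⟩
    g (suc i) * binom m i + shifted i
      ≡⟨ ℤₚ.+-comm _ (shifted i) ⟩
    shifted i + g (suc i) * binom m i ∎
  binom-top : binom m (suc m) ≡ 0ℤ
  binom-top = cong +_ (k>n⇒nCk≡0 (ℕₚ.n<1+n m))
  drop-zero : ∀ a s c t → a + (s + c * 0ℤ + t) ≡ a + s + t
  drop-zero = solve-∀

-- For f of period p + 1, so that n * p acts as −n, this is Σ_{|k| ≤ n} f k · C(2n, n + k).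
centredSum : ℕ → (ℕ → ℤ) → ℕ → ℤ
centredSum p f n = binomialSum (2 ℕ.* n) (λ i → f (n ℕ.* p ℕ.+ i))

smooth : ℕ → (ℕ → ℤ) → ℕ → ℤ
smooth p f j = f (p ℕ.+ j) + + 2 * f (p ℕ.+ suc j) + f (p ℕ.+ suc (suc j))

centredSum-suc : ∀ p f n → centredSum p f (suc n) ≡ centredSum p (smooth p f) n
centredSum-suc p f n = begin
  binomialSum (2 ℕ.* suc n) g
    ≡⟨ cong (λ k → binomialSum k g) (ℕₚ.*-suc 2 n) ⟩
  binomialSum (suc (suc m)) g
    ≡⟨ binomialSum-suc (suc m) g ⟩
  binomialSum (suc m) g + binomialSum (suc m) g₁
    ≡⟨ cong₂ _+_ (binomialSum-suc m g) (binomialSum-suc m g₁) ⟩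
  binomialSum m g + binomialSum m g₁ + (binomialSum m g₁ + binomialSum m g₂)
    ≡⟨ collect (binomialSum m g) (binomialSum m g₁) (binomialSum m g₂) ⟩
  binomialSum m g + + 2 * binomialSum m g₁ + binomialSum m g₂
    ≡⟨ cong (λ t → binomialSum m g + t + binomialSum m g₂) (sym (binomialSum-*ˡ m (+ 2) g₁)) ⟩
  binomialSum m g + binomialSum m (λ i → + 2 * g₁ i) + binomialSum m g₂
    ≡⟨ cong (_+ binomialSum m g₂) (sym (binomialSum-+ m g (λ i → + 2 * g₁ i))) ⟩
  binomialSum m (λ i → g i + + 2 * g₁ i) + binomialSum m g₂
    ≡⟨ sym (binomialSum-+ m (λ i → g i + + 2 * g₁ i) g₂) ⟩
  binomialSum m (λ i → g i + + 2 * g₁ i + g₂ i)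
    ≡⟨ binomialSum-cong m realign ⟩
  centredSum p (smooth p f) n ∎
  where
  m : ℕ
  m = 2 ℕ.* n
  g g₁ g₂ : ℕ → ℤ
  g i = f (suc n ℕ.* p ℕ.+ i)
  g₁ i = g (suc i)
  g₂ i = g (suc (suc i))
  collect : ∀ a b c → a + b + (b + c) ≡ a + + 2 * b + c
  collect = solve-∀
  index₀ : ∀ n p i → suc n ℕ.* p ℕ.+ i ≡ p ℕ.+ (n ℕ.* p ℕ.+ i)
  index₀ = ℕ-Solver.solve-∀
  index₁ : ∀ n p i → suc n ℕ.* p ℕ.+ suc i ≡ p ℕ.+ suc (n ℕ.* p ℕ.+ i)
  index₁ = ℕ-Solver.solve-∀
  index₂ : ∀ n p i → suc n ℕ.* p ℕ.+ suc (suc i) ≡ p ℕ.+ suc (suc (n ℕ.* p ℕ.+ i))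
  index₂ = ℕ-Solver.solve-∀
  realign : ∀ i → g i + + 2 * g₁ i + g₂ i ≡ smooth p f (n ℕ.* p ℕ.+ i)
  realign i = cong₂ _+_ (cong₂ _+_ (cong f (index₀ n p i)) (cong (λ k → + 2 * f k) (index₁ n p i)))
                        (cong f (index₂ n p i))

centredSum-recurrence : ∀ p f → (∀ j → smooth p (smooth p f) j + f j ≡ + 4 * smooth p f j) →
  ∀ n → centredSum p f (suc (suc n)) + centredSum p f n ≡ + 4 * centredSum p f (suc n)
centredSum-recurrence p f smooth²-rel n = begin
  centredSum p f (suc (suc n)) + centredSum p f n
    ≡⟨ cong (_+ centredSum p f n) (trans (centredSum-suc p f (suc n)) (centredSum-suc p (smooth p f) n)) ⟩
  centredSum p (smooth p (smooth p f)) n + centredSum p f n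
    ≡⟨ sym (binomialSum-+ (2 ℕ.* n) (λ i → smooth p (smooth p f) (n ℕ.* p ℕ.+ i)) (λ i → f (n ℕ.* p ℕ.+ i))) ⟩
  binomialSum (2 ℕ.* n) (λ i → smooth p (smooth p f) (n ℕ.* p ℕ.+ i) + f (n ℕ.* p ℕ.+ i))
    ≡⟨ binomialSum-cong (2 ℕ.* n) (λ i → smooth²-rel (n ℕ.* p ℕ.+ i)) ⟩
  binomialSum (2 ℕ.* n) (λ i → + 4 * smooth p f (n ℕ.* p ℕ.+ i))
    ≡⟨ binomialSum-*ˡ (2 ℕ.* n) (+ 4) (λ i → smooth p f (n ℕ.* p ℕ.+ i)) ⟩
  + 4 * centredSum p (smooth p f) n
    ≡⟨ cong (+ 4 *_) (sym (centredSum-suc p f n)) ⟩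
  + 4 * centredSum p f (suc n) ∎

Y : ℕ → ℤ
Y 0             = 0ℤ
Y 1             = 1ℤ
Y (suc (suc n)) = + 4 * Y (suc n) - Y n

α^√≡ : ∀ n → α ^√ n ≡ ⟨ Y (suc n) - + 2 * Y n , Y n ⟩
α^√≡ zero    = refl
α^√≡ (suc n) rewrite α^√≡ n = cong₂ ⟨_,_⟩ (re-step (Y (suc n)) (Y n)) (im-step (Y (suc n)) (Y n))
  where
  re-step : ∀ a b → + 2 * (a - + 2 * b) + + 3 * (1ℤ * b) ≡ + 4 * a - b - + 2 * a
  re-step = solve-∀
  im-step : ∀ a b → + 2 * b + 1ℤ * (a - + 2 * b) ≡ a
  im-step = solve-∀

β^√≡ : ∀ n → β ^√ n ≡ ⟨ Y (suc n) - + 2 * Y n , - Y n ⟩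
β^√≡ zero    = refl
β^√≡ (suc n) rewrite β^√≡ n = cong₂ ⟨_,_⟩ (re-step (Y (suc n)) (Y n)) (im-step (Y (suc n)) (Y n))
  where
  re-step : ∀ a b → + 2 * (a - + 2 * b) + + 3 * (- 1ℤ * - b) ≡ + 4 * a - b - + 2 * a
  re-step = solve-∀
  im-step : ∀ a b → + 2 * - b + - 1ℤ * (a - + 2 * b) ≡ - a
  im-step = solve-∀

IsY-Y : ∀ n → IsY n (Y n)
IsY-Y n rewrite α^√≡ n | β^√≡ n = cong₂ ⟨_,_⟩ (re-part (Y (suc n)) (Y n)) (im-part (Y n))
  where
  re-part : ∀ a b → a - + 2 * b - (a - + 2 * b) ≡ 0ℤ * b + + 3 * (+ 2 * 0ℤ)
  re-part = solve-∀
  im-part : ∀ b → b - - b ≡ 0ℤ * 0ℤ + + 2 * b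
  im-part = solve-∀

Y-unique : ∀ (u : ℕ → ℤ) c → u 0 ≡ 0ℤ → u 1 ≡ c →
           (∀ n → u (suc (suc n)) + u n ≡ + 4 * u (suc n)) → ∀ n → u n ≡ c * Y n
Y-unique u c u₀ u₁ rec zero          = trans u₀ (sym (ℤₚ.*-zeroʳ c))
Y-unique u c u₀ u₁ rec (suc zero)    = trans u₁ (sym (ℤₚ.*-identityʳ c))
Y-unique u c u₀ u₁ rec (suc (suc n)) = begin
  u (suc (suc n))                   ≡⟨ isolate (u (suc (suc n))) (u n) ⟩
  u (suc (suc n)) + u n - u n       ≡⟨ cong (_- u n) (rec n) ⟩
  + 4 * u (suc n) - u n             ≡⟨ cong₂ (λ a b → + 4 * a - b) (Y-unique u c u₀ u₁ rec (suc n))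
                                                                    (Y-unique u c u₀ u₁ rec n) ⟩
  + 4 * (c * Y (suc n)) - c * Y n   ≡⟨ factor c (Y (suc n)) (Y n) ⟩
  c * Y (suc (suc n))               ∎
  where
  isolate : ∀ a b → a ≡ a + b - b
  isolate = solve-∀
  factor : ∀ c a b → + 4 * (c * a) - c * b ≡ c * (+ 4 * a - b)
  factor = solve-∀

χ : ℕ → ℤ
χ 0  = 0ℤ
χ 1  = 1ℤ
χ 2  = 0ℤ
χ 3  = 0ℤ
χ 4  = 0ℤ
χ 5  = - 1ℤ
χ 6  = 0ℤ
χ 7  = - 1ℤ
χ 8  = 0ℤ
χ 9  = 0ℤ
χ 10 = 0ℤ
χ 11 = 1ℤ
χ (suc (suc (suc (suc (suc (suc (suc (suc (suc (suc (suc (suc k)))))))))))) = χ k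

χ[12d+y]≡χ[y] : ∀ d y → χ (d ℕ.* 12 ℕ.+ y) ≡ χ y
χ[12d+y]≡χ[y] zero    y = refl
χ[12d+y]≡χ[y] (suc d) y = χ[12d+y]≡χ[y] d y

-- 11 ≡ −1 (mod 12): this is the evenness of χ.
χ[11y]≡χ[y] : ∀ y → χ (y ℕ.* 11) ≡ χ y
χ[11y]≡χ[y] 0  = refl
χ[11y]≡χ[y] 1  = refl
χ[11y]≡χ[y] 2  = refl
χ[11y]≡χ[y] 3  = refl
χ[11y]≡χ[y] 4  = refl
χ[11y]≡χ[y] 5  = refl
χ[11y]≡χ[y] 6  = refl
χ[11y]≡χ[y] 7  = refl
χ[11y]≡χ[y] 8  = refl
χ[11y]≡χ[y] 9  = refl
χ[11y]≡χ[y] 10 = refl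
χ[11y]≡χ[y] 11 = refl
χ[11y]≡χ[y] (suc (suc (suc (suc (suc (suc (suc (suc (suc (suc (suc (suc y)))))))))))) = begin
  χ ((12 ℕ.+ y) ℕ.* 11)      ≡⟨ cong χ (ℕₚ.*-distribʳ-+ 11 12 y) ⟩
  χ (11 ℕ.* 12 ℕ.+ y ℕ.* 11) ≡⟨ χ[12d+y]≡χ[y] 11 (y ℕ.* 11) ⟩
  χ (y ℕ.* 11)               ≡⟨ χ[11y]≡χ[y] y ⟩
  χ y                        ∎

χ[6+y]≡-χ[y] : ∀ y → χ (6 ℕ.+ y) ≡ - χ y
χ[6+y]≡-χ[y] 0  = refl
χ[6+y]≡-χ[y] 1  = refl
χ[6+y]≡-χ[y] 2  = refl
χ[6+y]≡-χ[y] 3  = refl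
χ[6+y]≡-χ[y] 4  = refl
χ[6+y]≡-χ[y] 5  = refl
χ[6+y]≡-χ[y] 6  = refl
χ[6+y]≡-χ[y] 7  = refl
χ[6+y]≡-χ[y] 8  = refl
χ[6+y]≡-χ[y] 9  = refl
χ[6+y]≡-χ[y] 10 = refl
χ[6+y]≡-χ[y] 11 = refl
χ[6+y]≡-χ[y] (suc (suc (suc (suc (suc (suc (suc (suc (suc (suc (suc (suc y)))))))))))) = χ[6+y]≡-χ[y] y

χ[6j+y]≡sgn[j]χ[y] : ∀ j y → χ (j ℕ.* 6 ℕ.+ y) ≡ sgn j * χ y
χ[6j+y]≡sgn[j]χ[y] zero    y = sym (ℤₚ.*-identityˡ (χ y))
χ[6j+y]≡sgn[j]χ[y] (suc j) y = begin
  χ (6 ℕ.+ (j ℕ.* 6 ℕ.+ y)) ≡⟨ χ[6+y]≡-χ[y] (j ℕ.* 6 ℕ.+ y) ⟩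
  - χ (j ℕ.* 6 ℕ.+ y)       ≡⟨ cong -_ (χ[6j+y]≡sgn[j]χ[y] j y) ⟩
  - (sgn j * χ y)           ≡⟨ ℤₚ.neg-distribˡ-* (sgn j) (χ y) ⟩
  - sgn j * χ y             ∎

χ[2y]≡0 : ∀ y → χ (y ℕ.* 2) ≡ 0ℤ
χ[2y]≡0 0 = refl
χ[2y]≡0 1 = refl
χ[2y]≡0 2 = refl
χ[2y]≡0 3 = refl
χ[2y]≡0 4 = refl
χ[2y]≡0 5 = refl
χ[2y]≡0 (suc (suc (suc (suc (suc (suc y)))))) = χ[2y]≡0 y

χ[2m+1]≡sgn[m]kron12 : ∀ m → χ (2 ℕ.* m ℕ.+ 1) ≡ sgn m * kron12 (2 ℕ.* m ℕ.+ 1)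
χ[2m+1]≡sgn[m]kron12 0 = refl
χ[2m+1]≡sgn[m]kron12 1 = refl
χ[2m+1]≡sgn[m]kron12 2 = refl
χ[2m+1]≡sgn[m]kron12 3 = refl
χ[2m+1]≡sgn[m]kron12 4 = refl
χ[2m+1]≡sgn[m]kron12 5 = refl
χ[2m+1]≡sgn[m]kron12 (suc (suc (suc (suc (suc (suc m)))))) = begin
  χ (2 ℕ.* (6 ℕ.+ m) ℕ.+ 1)                            ≡⟨ cong χ (add-12 m) ⟩
  χ (2 ℕ.* m ℕ.+ 1)                                    ≡⟨ χ[2m+1]≡sgn[m]kron12 m ⟩
  sgn m * kron12 (2 ℕ.* m ℕ.+ 1)                       ≡⟨ cong (_* kron12 (2 ℕ.* m ℕ.+ 1)) (sym sgn[6+m]) ⟩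
  sgn (6 ℕ.+ m) * kron12 (12 ℕ.+ (2 ℕ.* m ℕ.+ 1))      ≡⟨ cong (λ k → sgn (6 ℕ.+ m) * kron12 k) (sym (add-12 m)) ⟩
  sgn (6 ℕ.+ m) * kron12 (2 ℕ.* (6 ℕ.+ m) ℕ.+ 1)      ∎
  where
  add-12 : ∀ m → 2 ℕ.* (6 ℕ.+ m) ℕ.+ 1 ≡ 12 ℕ.+ (2 ℕ.* m ℕ.+ 1)
  add-12 = ℕ-Solver.solve-∀
  sgn[6+m] : sgn (6 ℕ.+ m) ≡ sgn m
  sgn[6+m] = trans (ℤₚ.neg-involutive _) (trans (ℤₚ.neg-involutive _) (ℤₚ.neg-involutive _))

smooth²-χ : ∀ j → smooth 11 (smooth 11 χ) j + χ j ≡ + 4 * smooth 11 χ j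
smooth²-χ 0  = refl
smooth²-χ 1  = refl
smooth²-χ 2  = refl
smooth²-χ 3  = refl
smooth²-χ 4  = refl
smooth²-χ 5  = refl
smooth²-χ 6  = refl
smooth²-χ 7  = refl
smooth²-χ 8  = refl
smooth²-χ 9  = refl
smooth²-χ 10 = refl
smooth²-χ 11 = refl
smooth²-χ (suc (suc (suc (suc (suc (suc (suc (suc (suc (suc (suc (suc j)))))))))))) = smooth²-χ j

χTerm : ℕ → ℕ → ℤ
χTerm n r = χ (suc r) * binom (2 ℕ.* n) (n ℕ.+ suc r)

Σχ : ℕ → ℤ
Σχ n = Σ< n (χTerm n)

1+2n≡n+[1+n] : ∀ n → suc (2 ℕ.* n) ≡ n ℕ.+ suc n
1+2n≡n+[1+n] = ℕ-Solver.solve-∀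

χTerm-vanishes : ∀ {n r} → n ≤ r → χTerm n r ≡ 0ℤ
χTerm-vanishes {n} {r} n≤r = begin
  χ (suc r) * + (2 ℕ.* n C (n ℕ.+ suc r)) ≡⟨ cong (λ c → χ (suc r) * + c) (k>n⇒nCk≡0 2n<n+1+r) ⟩
  χ (suc r) * 0ℤ                          ≡⟨ ℤₚ.*-zeroʳ (χ (suc r)) ⟩
  0ℤ                                      ∎
  where
  2n<n+1+r : 2 ℕ.* n < n ℕ.+ suc r
  2n<n+1+r = ℕₚ.≤-trans (ℕₚ.≤-reflexive (1+2n≡n+[1+n] n)) (ℕₚ.+-monoʳ-≤ n (s≤s n≤r))

χ-mirror : ∀ s d → χ ((s ℕ.+ d) ℕ.* 11 ℕ.+ d) * binom (2 ℕ.* (s ℕ.+ d)) d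
                 ≡ χ s * binom (2 ℕ.* (s ℕ.+ d)) (s ℕ.+ d ℕ.+ s)
χ-mirror s d = cong₂ _*_ χ-part (cong +_ binom-part)
  where
  N : ℕ
  N = 2 ℕ.* (s ℕ.+ d)
  regroup : ∀ s d → (s ℕ.+ d) ℕ.* 11 ℕ.+ d ≡ d ℕ.* 12 ℕ.+ s ℕ.* 11
  regroup = ℕ-Solver.solve-∀
  unfold : ∀ s d → 2 ℕ.* (s ℕ.+ d) ≡ s ℕ.+ d ℕ.+ s ℕ.+ d
  unfold = ℕ-Solver.solve-∀
  χ-part : χ ((s ℕ.+ d) ℕ.* 11 ℕ.+ d) ≡ χ s
  χ-part = trans (cong χ (regroup s d)) (trans (χ[12d+y]≡χ[y] d (s ℕ.* 11)) (χ[11y]≡χ[y] s))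
  binom-part : N C d ≡ N C (s ℕ.+ d ℕ.+ s)
  binom-part = begin
    N C d                      ≡⟨ nCk≡nC[n∸k] (ℕₚ.≤-trans (ℕₚ.m≤n+m d _) (ℕₚ.≤-reflexive (sym (unfold s d)))) ⟩
    N C (N ℕ.∸ d)              ≡⟨ cong (λ k → N C (k ℕ.∸ d)) (unfold s d) ⟩
    N C (s ℕ.+ d ℕ.+ s ℕ.+ d ℕ.∸ d) ≡⟨ cong (N C_) (ℕₚ.m+n∸n≡m (s ℕ.+ d ℕ.+ s) d) ⟩
    N C (s ℕ.+ d ℕ.+ s)        ∎

-- The terms with i ≥ n give Σχ n directly (χ 0 = 0 kills the middle one); those with i < n
-- give it after the reflection i ↦ 2n − i, by χ-mirror.
centredSum-χ : ∀ n → centredSum 11 χ n ≡ Σχ n + Σχ n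
centredSum-χ n = begin
  Σ< (suc (2 ℕ.* n)) h                     ≡⟨ cong (λ K → Σ< K h) (1+2n≡n+[1+n] n) ⟩
  Σ< (n ℕ.+ suc n) h                       ≡⟨ Σ<-split n (suc n) h ⟩
  Σ< n h + Σ< (suc n) (λ r → h (n ℕ.+ r))  ≡⟨ cong₂ _+_ lower upper ⟩
  Σχ n + Σχ n                              ∎
  where
  h : ℕ → ℤ
  h i = χ (n ℕ.* 11 ℕ.+ i) * binom (2 ℕ.* n) i
  regroup : ∀ n r → n ℕ.* 11 ℕ.+ (n ℕ.+ r) ≡ n ℕ.* 12 ℕ.+ r
  regroup = ℕ-Solver.solve-∀
  χ-upper : ∀ r → χ (n ℕ.* 11 ℕ.+ (n ℕ.+ r)) ≡ χ r
  χ-upper r = trans (cong χ (regroup n r)) (χ[12d+y]≡χ[y] n r)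
  upper : Σ< (suc n) (λ r → h (n ℕ.+ r)) ≡ Σχ n
  upper = begin
    Σ< (suc n) (λ r → h (n ℕ.+ r))
      ≡⟨ Σ<-cong (suc n) (λ r → cong (_* binom (2 ℕ.* n) (n ℕ.+ r)) (χ-upper r)) ⟩
    Σ< (suc n) (λ r → χ r * binom (2 ℕ.* n) (n ℕ.+ r))
      ≡⟨ Σ<-head n _ ⟩
    0ℤ + Σχ n
      ≡⟨ ℤₚ.+-identityˡ (Σχ n) ⟩
    Σχ n ∎
  reflected : ∀ r → r < n → h (n ℕ.∸ suc r) ≡ χTerm n r
  reflected r r<n =
    subst (λ N → χ (N ℕ.* 11 ℕ.+ d) * binom (2 ℕ.* N) d ≡ χ (suc r) * binom (2 ℕ.* N) (N ℕ.+ suc r))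
          (ℕₚ.m+[n∸m]≡n r<n) (χ-mirror (suc r) d)
    where
    d : ℕ
    d = n ℕ.∸ suc r
  lower : Σ< n h ≡ Σχ n
  lower = trans (Σ<-reverse n h) (Σ<-cong-< n reflected)

Σχ-blocks : ∀ n b .{{_ : ℕ.NonZero b}} →
            Σχ n ≡ Σ< (suc n) (λ j → Σ< b (λ k → χTerm n (j ℕ.* b ℕ.+ k)))
Σχ-blocks n b = trans (sym (Σ<-truncate (suc n ℕ.* b) (χTerm n) n≤[1+n]b (λ r → χTerm-vanishes)))
                      (Σ<-blocks (suc n) b (χTerm n))
  where
  n≤[1+n]b : n ≤ suc n ℕ.* b
  n≤[1+n]b = ℕₚ.≤-trans (ℕₚ.m≤m*n n b) (ℕₚ.m≤n+m (n ℕ.* b) b)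

S₂≡Σχ : ∀ n → S₂ n ≡ Σχ n
S₂≡Σχ n = sym (trans (Σχ-blocks n 6) (Σ<-cong (suc n) block))
  where
  bb : ℕ → ℤ
  bb = binom (2 ℕ.* n)
  χ-shift : ∀ j k → χ (suc (j ℕ.* 6 ℕ.+ k)) ≡ sgn j * χ (suc k)
  χ-shift j k = trans (cong χ (sym (ℕₚ.+-suc (j ℕ.* 6) k))) (χ[6j+y]≡sgn[j]χ[y] j (suc k))
  keep-1-and-5 : ∀ s x₀ x₁ x₂ x₃ x₄ x₅ →
    0ℤ + s * 1ℤ * x₀ + s * 0ℤ * x₁ + s * 0ℤ * x₂ + s * 0ℤ * x₃ + s * - 1ℤ * x₄ + s * 0ℤ * x₅
      ≡ s * (x₀ - x₄)
  keep-1-and-5 = solve-∀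
  index₁ : ∀ n j → n ℕ.+ suc (j ℕ.* 6 ℕ.+ 0) ≡ n ℕ.+ 6 ℕ.* j ℕ.+ 1
  index₁ = ℕ-Solver.solve-∀
  index₅ : ∀ n j → n ℕ.+ suc (j ℕ.* 6 ℕ.+ 4) ≡ n ℕ.+ 6 ℕ.* j ℕ.+ 5
  index₅ = ℕ-Solver.solve-∀
  block : ∀ j → Σ< 6 (λ k → χTerm n (j ℕ.* 6 ℕ.+ k))
              ≡ sgn j * (bb (n ℕ.+ 6 ℕ.* j ℕ.+ 1) - bb (n ℕ.+ 6 ℕ.* j ℕ.+ 5))
  block j = begin
    Σ< 6 (λ k → χTerm n (j ℕ.* 6 ℕ.+ k))
      ≡⟨ Σ<-cong 6 (λ k → cong (_* bb (n ℕ.+ suc (j ℕ.* 6 ℕ.+ k))) (χ-shift j k)) ⟩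
    Σ< 6 (λ k → sgn j * χ (suc k) * bb (n ℕ.+ suc (j ℕ.* 6 ℕ.+ k)))
      ≡⟨ keep-1-and-5 (sgn j) _ _ _ _ _ _ ⟩
    sgn j * (bb (n ℕ.+ suc (j ℕ.* 6 ℕ.+ 0)) - bb (n ℕ.+ suc (j ℕ.* 6 ℕ.+ 4)))
      ≡⟨ cong₂ (λ a b → sgn j * (bb a - bb b)) (index₁ n j) (index₅ n j) ⟩
    sgn j * (bb (n ℕ.+ 6 ℕ.* j ℕ.+ 1) - bb (n ℕ.+ 6 ℕ.* j ℕ.+ 5)) ∎

S₁≡Σχ : ∀ n → S₁ n ≡ Σχ n
S₁≡Σχ n = sym (trans (Σχ-blocks n 2) (Σ<-cong (suc n) block))
  where
  bb : ℕ → ℤ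
  bb = binom (2 ℕ.* n)
  odd-index : ∀ m → suc (m ℕ.* 2 ℕ.+ 0) ≡ 2 ℕ.* m ℕ.+ 1
  odd-index = ℕ-Solver.solve-∀
  even-index : ∀ m → suc (m ℕ.* 2 ℕ.+ 1) ≡ suc m ℕ.* 2
  even-index = ℕ-Solver.solve-∀
  reorder : ∀ s k b → 0ℤ + s * k * b + 0ℤ ≡ s * b * k
  reorder = solve-∀
  block : ∀ m → Σ< 2 (λ k → χTerm n (m ℕ.* 2 ℕ.+ k))
              ≡ sgn m * bb (n ℕ.+ (2 ℕ.* m ℕ.+ 1)) * kron12 (2 ℕ.* m ℕ.+ 1)
  block m = begin
    0ℤ + χTerm n (m ℕ.* 2 ℕ.+ 0) + χTerm n (m ℕ.* 2 ℕ.+ 1) ≡⟨ cong₂ (λ a b → 0ℤ + a + b) odd-term even-term ⟩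
    0ℤ + sgn m * kron12 k * bb (n ℕ.+ k) + 0ℤ              ≡⟨ reorder (sgn m) (kron12 k) (bb (n ℕ.+ k)) ⟩
    sgn m * bb (n ℕ.+ k) * kron12 k                         ∎
    where
    k : ℕ
    k = 2 ℕ.* m ℕ.+ 1
    odd-term : χTerm n (m ℕ.* 2 ℕ.+ 0) ≡ sgn m * kron12 k * bb (n ℕ.+ k)
    odd-term = trans (cong (λ i → χ i * bb (n ℕ.+ i)) (odd-index m))
                     (cong (_* bb (n ℕ.+ k)) (χ[2m+1]≡sgn[m]kron12 m))
    even-term : χTerm n (m ℕ.* 2 ℕ.+ 1) ≡ 0ℤ
    even-term = trans (cong (λ i → χ i * bb (n ℕ.+ suc (m ℕ.* 2 ℕ.+ 1))) (even-index m))
                      (cong (_* bb (n ℕ.+ suc (m ℕ.* 2 ℕ.+ 1))) (χ[2y]≡0 (suc m)))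

Σχ≡Y : ∀ n → Σχ n ≡ Y n
Σχ≡Y n = ℤₚ.*-cancelˡ-≡ (+ 2) (Σχ n) (Y n) (begin
  + 2 * Σχ n        ≡⟨ double (Σχ n) ⟩
  Σχ n + Σχ n       ≡⟨ sym (centredSum-χ n) ⟩
  centredSum 11 χ n ≡⟨ Y-unique (centredSum 11 χ) (+ 2) refl refl (centredSum-recurrence 11 χ smooth²-χ) n ⟩
  + 2 * Y n         ∎)
  where
  double : ∀ a → + 2 * a ≡ a + a
  double = solve-∀

mainTheorem4 : (n : ℕ) → IsY n (S₁ n) × IsY n (S₂ n)
mainTheorem4 n = subst (IsY n) (sym S₁≡Y) (IsY-Y n) , subst (IsY n) (sym S₂≡Y) (IsY-Y n)
  where
  S₁≡Y : S₁ n ≡ Y n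
  S₁≡Y = trans (S₁≡Σχ n) (Σχ≡Y n)
  S₂≡Y : S₂ n ≡ Y n
  S₂≡Y = trans (S₂≡Σχ n) (Σχ≡Y n)
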